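{- Consider a rooted tree obtained from a star with a white center and $B$ black leaves by splits and contractions, and suppose a $\mathrm{split}(u,M)$ creates a new node $v$. Then: (1) if the edge $(v,u)$ is light, then for each light child $c$ of $v$, every node in $T_c$ had its light depth increased by $1$ by the split; (2) if $(v,u)$ is heavy and $v$ has a heavy child $c$ with $s(c)\le\frac12 s(u)$, then every node in $T_c$ had its light depth decreased by $1$ by the split; (3) otherwise the split did not change the light depth of any node.
   Context: Nodes are black or white; $N(u)$ is the neighbour set of $u$ (including its parent), $d(u)=|N(u)|$. $\mathrm{split}(u,M)$: given a white $u$ with $d(u)\ge2$ and $M\subset N(u)$, $1\le|M|\le\frac12 d(u)$, insert a new white child $v$ of $u$; let $M'=M$ if $u$ is the root or $\mathrm{parent}(u)\notin M$, else $M'=N(u)\setminus M$; make each node of $M'$ a child of $v$. $\mathrm{contract}$ of an edge from child $c$ to parent $p$: remove $c$, make its children children of $p$, turn $p$ black. Black weight $b(u)$: $0$ if $u$ is white, else the number of original black leaves contracted to form $u$. Size $s(u)=\sum_{w\in T_u}b(w)$ with $T_u$ the subtree of $u$. An edge from child $c$ to parent $p$ is heavy if $s(c)>\frac12 s(p)$ (then $c$ is a heavy child), light otherwise. The light depth of a node is the number of light edges on its root path. -}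

module Defs where

open import Data.Nat using (ℕ; zero; suc; _+_; _*_; _≤_; _<_; _≟_; _<ᵇ_; _≡ᵇ_)
open import Data.Bool using (Bool; true; false; if_then_else_; not; _∨_)
open import Data.List using (List; []; _∷_; _++_; [_]; map; length; filterᵇ; upTo)
open import Data.Maybe using (Maybe; just; nothing; maybe)
open import Data.Product using (Σ; ∃; _×_; _,_)
open import Data.List.Membership.Propositional using (_∈_; _∉_)
open import Data.List.Relation.Unary.All using (All)
open import Data.List.Relation.Unary.Unique.Propositional using (Unique)
open import Relation.Binary.PropositionalEquality using (_≡_; _≢_)

-- Rooted trees with node identities.
-- node x black cnt children :
--   x      : identity of the node (used to track nodes across operations)
--   black  : colour (true = black, false = white)
--   cnt    : number of original black leaves contracted to form the node
--   children : list of child subtrees (order irrelevant)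

data Tree : Set where
  node : ℕ → Bool → ℕ → List Tree → Tree

rootId : Tree → ℕ
rootId (node x _ _ _) = x

elem : ℕ → List ℕ → Bool
elem x [] = false
elem x (y ∷ ys) = (x ≡ᵇ y) ∨ elem x ys

bw : Tree → ℕ
bw (node _ true k _) = k
bw (node _ false _ _) = 0

mutual
  sz : Tree → ℕ
  sz t@(node _ _ _ cs) = bw t + szL cs

  szL : List Tree → ℕ
  szL [] = 0
  szL (c ∷ cs) = sz c + szL cs

mutual
  ids : Tree → List ℕ
  ids (node x _ _ cs) = x ∷ idsL cs

  idsL : List Tree → List ℕ
  idsL [] = []
  idsL (c ∷ cs) = ids c ++ idsL cs

orElse : {A : Set} → Maybe A → Maybe A → Maybe A
orElse (just a) _ = just a
orElse nothing m = m

mutual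
  sub : ℕ → Tree → Maybe Tree
  sub x t@(node y _ _ cs) = if x ≡ᵇ y then just t else subL x cs

  subL : ℕ → List Tree → Maybe Tree
  subL x [] = nothing
  subL x (c ∷ cs) = orElse (sub x c) (subL x cs)

mutual
  parentOf : ℕ → Tree → Maybe ℕ
  parentOf x (node y _ _ cs) =
    if elem x (map rootId cs) then just y else parentL x cs

  parentL : ℕ → List Tree → Maybe ℕ
  parentL x [] = nothing
  parentL x (c ∷ cs) = orElse (parentOf x c) (parentL x cs)

children : Tree → List Tree
children (node _ _ _ cs) = cs

size : Tree → ℕ → ℕ
size T x = maybe sz 0 (sub x T)

childIds : Tree → ℕ → List ℕ
childIds T x = maybe (λ t → map rootId (children t)) [] (sub x T)

subIds : Tree → ℕ → List ℕ
subIds T x = maybe ids [] (sub x T)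

nbrs : Tree → ℕ → List ℕ
nbrs T x = maybe [_] [] (parentOf x T) ++ childIds T x

deg : Tree → ℕ → ℕ
deg T x = length (nbrs T x)

White : Tree → ℕ → Set
White T x = Σ ℕ λ k → Σ (List Tree) λ cs → sub x T ≡ just (node x false k cs)

-- the edge from child c to parent p is heavy: s(c) > s(p)/2, i.e. 2 s(c) > s(p)
Heavy : Tree → ℕ → ℕ → Set
Heavy T c p = size T p < 2 * size T c

-- Light depth: number of light edges on the root path of x.

lightBit : ℕ → ℕ → ℕ
lightBit sc sp = if sp <ᵇ 2 * sc then 0 else 1

ldStep : Maybe ℕ → ℕ → Maybe ℕ → Maybe ℕ
ldStep (just k) l _ = just (k + l)
ldStep nothing _ r = r

mutual
  ldT : ℕ → Tree → Maybe ℕ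
  ldT x t@(node y _ _ cs) = if x ≡ᵇ y then just 0 else ldL x (sz t) cs

  ldL : ℕ → ℕ → List Tree → Maybe ℕ
  ldL x sp [] = nothing
  ldL x sp (c ∷ cs) = ldStep (ldT x c) (lightBit (sz c) sp) (ldL x sp cs)

ld : Tree → ℕ → Maybe ℕ
ld T x = ldT x T

-- membership in M' for a child y of u, given the parent of u (nothing = root)
inM' : List ℕ → Maybe ℕ → ℕ → Bool
inM' M nothing y = elem y M
inM' M (just p) y = if elem p M then not (elem y M) else elem y M

mutual
  splitGo : ℕ → List ℕ → ℕ → Maybe ℕ → Tree → Tree
  splitGo u M v par (node x bl k cs) =
    if x ≡ᵇ u
    then node x bl k (filterᵇ (λ t → not (inM' M par (rootId t))) cs
                      ++ [ node v false 0 (filterᵇ (λ t → inM' M par (rootId t)) cs) ])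
    else node x bl k (splitL u M v x cs)

  splitL : ℕ → List ℕ → ℕ → ℕ → List Tree → List Tree
  splitL u M v p [] = []
  splitL u M v p (c ∷ cs) = splitGo u M v (just p) c ∷ splitL u M v p cs

split : ℕ → List ℕ → ℕ → Tree → Tree
split u M v T = splitGo u M v nothing T

record SplitPre (T : Tree) (u : ℕ) (M : List ℕ) (v : ℕ) : Set where
  field
    white   : White T u
    degree  : 2 ≤ deg T u
    M⊆N     : All (_∈ nbrs T u) M
    M-uniq  : Unique M
    M-nonempty : 1 ≤ length M
    M-half  : 2 * length M ≤ deg T u
    fresh   : v ∉ ids T

findChild : ℕ → List Tree → Maybe (Tree × List Tree)
findChild c [] = nothing
findChild c (t ∷ ts) with rootId t ≡ᵇ c | findChild c ts
... | true  | _ = just (t , ts)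
... | false | just (t' , ts') = just (t' , t ∷ ts')
... | false | nothing = nothing

mutual
  contractGo : ℕ → Tree → Tree
  contractGo c (node x bl k cs) = contractNode c x bl k cs (findChild c cs)

  contractNode : ℕ → ℕ → Bool → ℕ → List Tree → Maybe (Tree × List Tree) → Tree
  contractNode c x bl k cs (just (node _ _ kc ccs , rest)) = node x true (k + kc) (rest ++ ccs)
  contractNode c x bl k cs nothing = node x bl k (contractL c cs)

  contractL : ℕ → List Tree → List Tree
  contractL c [] = []
  contractL c (t ∷ ts) = contractGo c t ∷ contractL c ts

contract : ℕ → Tree → Tree
contract c T = contractGo c T

ContractPre : Tree → ℕ → Set
ContractPre T c = (c ∈ ids T) × (c ≢ rootId T)

star : ℕ → Tree
star B = node 0 false 0 (map (λ i → node (suc i) true 1 []) (upTo B))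

data Reachable (B : ℕ) : Tree → Set where
  start      : Reachable B (star B)
  bySplit    : ∀ {T} u M v → Reachable B T → SplitPre T u M v → Reachable B (split u M v T)
  byContract : ∀ {T} c → Reachable B T → ContractPre T c → Reachable B (contract c T)

module Submission where

-- A split at u rearranges only the children of u: it replaces the node
-- t0 = u[cs] by t1 = u[A ++ [v[B]]], where B is the part of cs moved below
-- the new node v and A the rest.  Writing the tree as a one-hole context C
-- around t0, the split tree is C around t1.  The proof has three layers.
--  * Local analysis: s(t1) = s(t0), and the light depth of a node x in a
--    child c of u is computed from the light bits of the edges c-u (before)
--    and c-v, v-u (after); comparing the bits gives the three cases.
--  * Transport: since s(t1) = s(t0), every light bit outside the hole is
--    unchanged, so an equality (or a +1 shift) of light depths inside the
--    hole lifts to the whole tree, and subtrees/sizes of nodes in the hole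
--    are read off locally.
--  * Invariant: node identities in reachable trees are pairwise distinct
--    (the star has distinct labels, contractions only drop labels, splits
--    add one fresh label); this makes "the child containing x" well defined
--    and lets the local computations go through.

open import Defs
open import Data.Nat using (ℕ; suc; _*_; _≤_)
open import Data.List using (List)
open import Data.Maybe using (Maybe)
open import Data.Product using (∃; _×_)
open import Data.List.Membership.Propositional using (_∈_)
open import Relation.Nullary using (¬_)
open import Relation.Binary.PropositionalEquality using (_≡_)

open import Data.Nat using (zero; _+_; _<_; _≟_; _<ᵇ_; _≡ᵇ_; z≤n; s≤s)
open import Data.Nat.Properties
open import Data.Bool using (Bool; true; false; not; T; if_then_else_)
open import Data.List using ([]; _∷_; _++_; [_]; map; filterᵇ; upTo)
open import Data.List.Properties using (++-assoc)
open import Data.Maybe using (just; nothing; maybe)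
import Data.Maybe as Maybe
open import Data.Maybe.Properties using (just-injective)
open import Data.Nat.Solver using (module +-*-Solver)
open import Data.Product using (_,_; proj₁; proj₂)
open import Data.Sum using (inj₁; inj₂)
open import Data.Empty using (⊥; ⊥-elim)
open import Data.List.Membership.Propositional using (_∉_)
open import Data.List.Membership.Propositional.Properties
  using (∈-++⁺ˡ; ∈-++⁺ʳ; ∈-++⁻; ∈-map⁻; ∈-map⁺; ∈-filter⁺; ∈-filter⁻)
open import Data.List.Membership.DecPropositional _≟_ using (_∈?_)
open import Data.List.Relation.Unary.Any using (here; there)
open import Data.List.Relation.Unary.All using (lookup; tabulate)
open import Data.List.Relation.Unary.AllPairs using ([]; _∷_)
open import Data.List.Relation.Unary.Unique.Propositional using (Unique)
import Data.List.Relation.Unary.Unique.Propositional.Properties as Unique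
open import Function using (id)
open import Relation.Nullary using (yes; no)
open import Relation.Nullary.Decidable using (T?)
open import Relation.Binary.PropositionalEquality
  using (_≢_; refl; sym; trans; cong; cong₂; subst; module ≡-Reasoning)

≡ᵇ-refl : ∀ n → (n ≡ᵇ n) ≡ true
≡ᵇ-refl zero = refl
≡ᵇ-refl (suc n) = ≡ᵇ-refl n

≢⇒≡ᵇ-false : ∀ {m n} → m ≢ n → (m ≡ᵇ n) ≡ false
≢⇒≡ᵇ-false {m} {n} m≢n with m ≡ᵇ n in eq
... | false = refl
... | true = ⊥-elim (m≢n (≡ᵇ⇒≡ m n (subst T (sym eq) _)))

≡ᵇ-true⇒≡ : ∀ {m n} → (m ≡ᵇ n) ≡ true → m ≡ n
≡ᵇ-true⇒≡ {m} {n} eq = ≡ᵇ⇒≡ m n (subst T (sym eq) _)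

-- Distinctness of labels is phrased as "every label
-- occurs at most once"; counts are additive over concatenation and
-- insensitive to reordering, which is what the contraction case needs.

occ : ℕ → List ℕ → ℕ
occ x [] = 0
occ x (y ∷ ys) = if x ≡ᵇ y then suc (occ x ys) else occ x ys

Distinct : List ℕ → Set
Distinct xs = ∀ x → occ x xs ≤ 1

occ-++ : ∀ x xs ys → occ x (xs ++ ys) ≡ occ x xs + occ x ys
occ-++ x [] ys = refl
occ-++ x (y ∷ xs) ys with x ≡ᵇ y
... | true = cong suc (occ-++ x xs ys)
... | false = occ-++ x xs ys

occ-head : ∀ x xs → occ x (x ∷ xs) ≡ suc (occ x xs)
occ-head x xs rewrite ≡ᵇ-refl x = refl

occ-∷-mono : ∀ x y xs ys → occ x xs ≤ occ x ys → occ x (y ∷ xs) ≤ occ x (y ∷ ys)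
occ-∷-mono x y xs ys le with x ≡ᵇ y
... | true = s≤s le
... | false = le

occ-∷-right : ∀ x y xs → occ x xs ≤ occ x (y ∷ xs)
occ-∷-right x y xs with x ≡ᵇ y
... | true = n≤1+n _
... | false = ≤-refl

∈⇒occ-pos : ∀ {x xs} → x ∈ xs → 1 ≤ occ x xs
∈⇒occ-pos {x} (here refl) rewrite ≡ᵇ-refl x = s≤s z≤n
∈⇒occ-pos {x} {y ∷ _} (there x∈) with x ≡ᵇ y
... | true = s≤s z≤n
... | false = ∈⇒occ-pos x∈

∉⇒occ-zero : ∀ {x xs} → x ∉ xs → occ x xs ≡ 0
∉⇒occ-zero {xs = []} x∉ = refl
∉⇒occ-zero {x} {y ∷ xs} x∉ with x ≡ᵇ y in eq
... | true = ⊥-elim (x∉ (here (≡ᵇ-true⇒≡ eq)))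
... | false = ∉⇒occ-zero (λ x∈ → x∉ (there x∈))

occ-pos⇒∈ : ∀ {x xs} → 1 ≤ occ x xs → x ∈ xs
occ-pos⇒∈ {x} {xs} pos with x ∈? xs
... | yes x∈ = x∈
... | no x∉ = ⊥-elim (<-irrefl refl (subst (1 ≤_) (∉⇒occ-zero x∉) pos))

distinct-disjoint : ∀ {x} xs ys → occ x (xs ++ ys) ≤ 1 → x ∈ xs → x ∉ ys
distinct-disjoint {x} xs ys once x∈xs x∈ys =
  <-irrefl refl (≤-trans (+-mono-≤ (∈⇒occ-pos x∈xs) (∈⇒occ-pos x∈ys))
                         (subst (_≤ 1) (occ-++ x xs ys) once))

unique⇒distinct : ∀ {xs} → Unique xs → Distinct xs
unique⇒distinct [] x = z≤n
unique⇒distinct {y ∷ ys} (y∉ys ∷ rest) x with x ≡ᵇ y in eq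
... | true with refl ← ≡ᵇ-true⇒≡ {x} {y} eq =
  s≤s (≤-reflexive (∉⇒occ-zero (λ y∈ → lookup y∉ys y∈ refl)))
... | false = unique⇒distinct rest x

sumOver : (Tree → ℕ) → List Tree → ℕ
sumOver f [] = 0
sumOver f (t ∷ ts) = f t + sumOver f ts

sumOver-++ : ∀ f xs ys → sumOver f (xs ++ ys) ≡ sumOver f xs + sumOver f ys
sumOver-++ f [] ys = refl
sumOver-++ f (x ∷ xs) ys = trans (cong (f x +_) (sumOver-++ f xs ys)) (sym (+-assoc (f x) _ _))

sumOver-partition : ∀ f (p : Tree → Bool) ts →
  sumOver f (filterᵇ (λ t → not (p t)) ts) + sumOver f (filterᵇ p ts) ≡ sumOver f ts
sumOver-partition f p [] = refl
sumOver-partition f p (t ∷ ts) with p t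
... | true = trans (+-comm (sumOver f (filterᵇ (λ t → not (p t)) ts)) _)
               (trans (+-assoc (f t) _ _)
                 (cong (f t +_) (trans (+-comm (sumOver f (filterᵇ p ts)) _) (sumOver-partition f p ts))))
... | false = trans (+-assoc (f t) _ _) (cong (f t +_) (sumOver-partition f p ts))

szL≡sumOver : ∀ ts → szL ts ≡ sumOver sz ts
szL≡sumOver [] = refl
szL≡sumOver (t ∷ ts) = cong (sz t +_) (szL≡sumOver ts)

occ-idsL≡sumOver : ∀ x ts → occ x (idsL ts) ≡ sumOver (λ t → occ x (ids t)) ts
occ-idsL≡sumOver x [] = refl
occ-idsL≡sumOver x (t ∷ ts) = trans (occ-++ x (ids t) (idsL ts)) (cong (occ x (ids t) +_) (occ-idsL≡sumOver x ts))

idsL-++ : ∀ xs ys → idsL (xs ++ ys) ≡ idsL xs ++ idsL ys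
idsL-++ [] ys = refl
idsL-++ (x ∷ xs) ys = trans (cong (ids x ++_) (idsL-++ xs ys)) (sym (++-assoc (ids x) (idsL xs) (idsL ys)))

szL-++ : ∀ xs ys → szL (xs ++ ys) ≡ szL xs + szL ys
szL-++ xs ys = trans (szL≡sumOver (xs ++ ys))
  (trans (sumOver-++ sz xs ys) (sym (cong₂ _+_ (szL≡sumOver xs) (szL≡sumOver ys))))

bw-node : ∀ y b k cs cs' → bw (node y b k cs) ≡ bw (node y b k cs')
bw-node y true k cs cs' = refl
bw-node y false k cs cs' = refl

rootId∈ids : ∀ t → rootId t ∈ ids t
rootId∈ids (node _ _ _ _) = here refl

∈-idsL⁺ : ∀ {x c} ts → c ∈ ts → x ∈ ids c → x ∈ idsL ts
∈-idsL⁺ (c ∷ ts) (here refl) x∈c = ∈-++⁺ˡ x∈c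
∈-idsL⁺ (d ∷ ts) (there c∈) x∈c = ∈-++⁺ʳ (ids d) (∈-idsL⁺ ts c∈ x∈c)

∈-idsL⁻ : ∀ {x} ts → x ∈ idsL ts → ∃ λ c → c ∈ ts × x ∈ ids c
∈-idsL⁻ (c ∷ ts) x∈ with ∈-++⁻ (ids c) x∈
... | inj₁ x∈c = c , here refl , x∈c
... | inj₂ x∈ts = let d , d∈ , x∈d = ∈-idsL⁻ ts x∈ts in d , there d∈ , x∈d

containing-tree-unique : ∀ {x c d} ts → occ x (idsL ts) ≤ 1 →
  d ∈ ts → c ∈ ts → x ∈ ids d → x ∈ ids c → d ≡ c
containing-tree-unique (e ∷ ts) once (here refl) (here refl) x∈d x∈c = refl
containing-tree-unique (e ∷ ts) once (here refl) (there c∈) x∈d x∈c =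
  ⊥-elim (distinct-disjoint (ids e) (idsL ts) once x∈d (∈-idsL⁺ ts c∈ x∈c))
containing-tree-unique (e ∷ ts) once (there d∈) (here refl) x∈d x∈c =
  ⊥-elim (distinct-disjoint (ids e) (idsL ts) once x∈c (∈-idsL⁺ ts d∈ x∈d))
containing-tree-unique {x} (e ∷ ts) once (there d∈) (there c∈) x∈d x∈c =
  containing-tree-unique ts (≤-trans (m≤n+m _ (occ x (ids e))) (subst (_≤ 1) (occ-++ x (ids e) (idsL ts)) once))
    d∈ c∈ x∈d x∈c

∉-head : ∀ {x y : ℕ} {ys} → x ∉ y ∷ ys → x ≢ y
∉-head x∉ x≡y = x∉ (here x≡y)

∉-tail : ∀ {x y : ℕ} {ys} → x ∉ y ∷ ys → x ∉ ys
∉-tail x∉ x∈ = x∉ (there x∈)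

≡ᵇ-false⇒≢ : ∀ {m n} → (m ≡ᵇ n) ≡ false → m ≢ n
≡ᵇ-false⇒≢ {m} eq refl with () ← trans (sym (≡ᵇ-refl m)) eq

mutual
  ldT-absent : ∀ x t → x ∉ ids t → ldT x t ≡ nothing
  ldT-absent x (node y _ _ cs) x∉ rewrite ≢⇒≡ᵇ-false (∉-head x∉) = ldL-absent x _ cs (∉-tail x∉)

  ldL-absent : ∀ x S cs → x ∉ idsL cs → ldL x S cs ≡ nothing
  ldL-absent x S [] x∉ = refl
  ldL-absent x S (c ∷ cs) x∉ rewrite ldT-absent x c (λ x∈ → x∉ (∈-++⁺ˡ x∈)) =
    ldL-absent x S cs (λ x∈ → x∉ (∈-++⁺ʳ (ids c) x∈))

mutual
  sub-absent : ∀ y t → y ∉ ids t → sub y t ≡ nothing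
  sub-absent y (node z _ _ cs) y∉ rewrite ≢⇒≡ᵇ-false (∉-head y∉) = subL-absent y cs (∉-tail y∉)

  subL-absent : ∀ y cs → y ∉ idsL cs → subL y cs ≡ nothing
  subL-absent y [] y∉ = refl
  subL-absent y (c ∷ cs) y∉ rewrite sub-absent y c (λ y∈ → y∉ (∈-++⁺ˡ y∈)) =
    subL-absent y cs (λ y∈ → y∉ (∈-++⁺ʳ (ids c) y∈))

mutual
  ldT-present : ∀ x t → x ∈ ids t → ∃ λ j → ldT x t ≡ just j
  ldT-present x (node y _ _ cs) x∈ with x ≡ᵇ y in eq
  ... | true = 0 , refl
  ... | false with x∈
  ...   | here x≡y = ⊥-elim (≡ᵇ-false⇒≢ eq x≡y)
  ...   | there x∈cs = ldL-present x _ cs x∈cs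

  ldL-present : ∀ x S cs → x ∈ idsL cs → ∃ λ j → ldL x S cs ≡ just j
  ldL-present x S (c ∷ cs) x∈ with ∈-++⁻ (ids c) x∈
  ... | inj₁ x∈c with ldT-present x c x∈c
  ...   | j , eq rewrite eq = _ , refl
  ldL-present x S (c ∷ cs) x∈ | inj₂ x∈cs with ldT x c
  ...   | just j = _ , refl
  ...   | nothing = ldL-present x S cs x∈cs

ldT-just⇒∈ : ∀ {x t j} → ldT x t ≡ just j → x ∈ ids t
ldT-just⇒∈ {x} {t} eq with x ∈? ids t
... | yes x∈ = x∈
... | no x∉ with () ← trans (sym (ldT-absent x t x∉)) eq

sub-just⇒∈ : ∀ {y t w} → sub y t ≡ just w → y ∈ ids t
sub-just⇒∈ {y} {t} eq with y ∈? ids t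
... | yes y∈ = y∈
... | no y∉ with () ← trans (sym (sub-absent y t y∉)) eq

ldL-through : ∀ x S c j ts → c ∈ ts → ldT x c ≡ just j →
  (∀ d → d ∈ ts → x ∈ ids d → d ≡ c) → ldL x S ts ≡ just (j + lightBit (sz c) S)
ldL-through x S c j (d ∷ ts) c∈ eq only with ldT x d in eqd
... | just j' with refl ← only d (here refl) (ldT-just⇒∈ eqd) with refl ← trans (sym eqd) eq = refl
ldL-through x S c j (d ∷ ts) (here refl) eq only | nothing with () ← trans (sym eqd) eq
ldL-through x S c j (d ∷ ts) (there c∈) eq only | nothing =
  ldL-through x S c j ts c∈ eq (λ d' d'∈ → only d' (there d'∈))

subL-through : ∀ y c w ts → c ∈ ts → sub y c ≡ just w →
  (∀ d → d ∈ ts → y ∈ ids d → d ≡ c) → subL y ts ≡ just w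
subL-through y c w (d ∷ ts) c∈ eq only with sub y d in eqd
... | just w' with refl ← only d (here refl) (sub-just⇒∈ eqd) with refl ← trans (sym eqd) eq = refl
subL-through y c w (d ∷ ts) (here refl) eq only | nothing with () ← trans (sym eqd) eq
subL-through y c w (d ∷ ts) (there c∈) eq only | nothing =
  subL-through y c w ts c∈ eq (λ d' d'∈ → only d' (there d'∈))

sub-root : ∀ t → sub (rootId t) t ≡ just t
sub-root (node y _ _ _) rewrite ≡ᵇ-refl y = refl

-- One-hole contexts.  Every node u of a tree T splits T into its subtree
-- T_u and the context around it; a split at u only changes T_u.

data Ctx : Set where
  hole : Ctx
  step : ℕ → Bool → ℕ → List Tree → Ctx → List Tree → Ctx

plug : Ctx → Tree → Tree
plug hole t = t
plug (step y b k ls C rs) t = node y b k (ls ++ plug C t ∷ rs)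

ctxIds : Ctx → List ℕ
ctxIds hole = []
ctxIds (step y b k ls C rs) = y ∷ (idsL ls ++ (ctxIds C ++ idsL rs))

∉-ctxIds-step : ∀ {x y} ls C rs → x ∉ y ∷ (idsL ls ++ (ctxIds C ++ idsL rs)) →
  (x ≢ y) × (x ∉ idsL ls) × (x ∉ ctxIds C) × (x ∉ idsL rs)
∉-ctxIds-step ls C rs x∉ =
  ∉-head x∉ , (λ x∈ → x∉ (there (∈-++⁺ˡ x∈))) ,
  (λ x∈ → x∉ (there (∈-++⁺ʳ (idsL ls) (∈-++⁺ˡ x∈)))) ,
  (λ x∈ → x∉ (there (∈-++⁺ʳ (idsL ls) (∈-++⁺ʳ (ctxIds C) x∈))))

mutual
  sub⇒plug : ∀ y t w → sub y t ≡ just w → ∃ λ C → t ≡ plug C w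
  sub⇒plug y (node z b k cs) w eq with y ≡ᵇ z
  ... | true = hole , just-injective eq
  ... | false with subL⇒plug y cs w eq
  ...   | ls , C , rs , refl = step z b k ls C rs , refl

  subL⇒plug : ∀ y cs w → subL y cs ≡ just w → ∃ λ ls → ∃ λ C → ∃ λ rs → cs ≡ ls ++ plug C w ∷ rs
  subL⇒plug y (c ∷ cs) w eq with sub y c in eqc
  ... | just w' with C , refl ← sub⇒plug y c w (trans eqc eq) = [] , C , cs , refl
  subL⇒plug y (c ∷ cs) w eq | nothing with ls , C , rs , refl ← subL⇒plug y cs w eq = c ∷ ls , C , rs , refl

occ-plug : ∀ x C t → occ x (ids (plug C t)) ≡ occ x (ctxIds C) + occ x (ids t)
occ-plug x hole t = refl
occ-plug x (step y b k ls C rs) t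
  rewrite occ-++ x [ y ] (idsL (ls ++ plug C t ∷ rs)) | occ-++ x [ y ] (idsL ls ++ (ctxIds C ++ idsL rs))
        | idsL-++ ls (plug C t ∷ rs)
        | occ-++ x (idsL ls) (ids (plug C t) ++ idsL rs) | occ-++ x (ids (plug C t)) (idsL rs)
        | occ-++ x (idsL ls) (ctxIds C ++ idsL rs) | occ-++ x (ctxIds C) (idsL rs)
        | occ-plug x C t
  = solve 5 (λ a b c d e → a :+ (b :+ ((c :+ d) :+ e)) := (a :+ (b :+ (c :+ e))) :+ d) refl
      (occ x [ y ]) (occ x (idsL ls)) (occ x (ctxIds C)) (occ x (ids t)) (occ x (idsL rs))
  where open +-*-Solver

∈-plug-hole : ∀ {x} C t → x ∈ ids t → x ∈ ids (plug C t)
∈-plug-hole {x} C t x∈ =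
  occ-pos⇒∈ (≤-trans (∈⇒occ-pos x∈) (≤-trans (m≤n+m _ (occ x (ctxIds C))) (≤-reflexive (sym (occ-plug x C t)))))

∈-plug-ctx : ∀ {x} C t → x ∈ ctxIds C → x ∈ ids (plug C t)
∈-plug-ctx {x} C t x∈ =
  occ-pos⇒∈ (≤-trans (∈⇒occ-pos x∈) (≤-trans (m≤m+n _ (occ x (ids t))) (≤-reflexive (sym (occ-plug x C t)))))

distinct-plug-hole : ∀ C t → Distinct (ids (plug C t)) → Distinct (ids t)
distinct-plug-hole C t dist x = ≤-trans (m≤n+m _ (occ x (ctxIds C))) (subst (_≤ 1) (occ-plug x C t) (dist x))

distinct-plug-apart : ∀ {x} C t → Distinct (ids (plug C t)) → x ∈ ids t → x ∉ ctxIds C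
distinct-plug-apart {x} C t dist x∈t x∈C =
  <-irrefl refl (≤-trans (+-mono-≤ (∈⇒occ-pos x∈C) (∈⇒occ-pos x∈t)) (subst (_≤ 1) (occ-plug x C t) (dist x)))

sz-plug : ∀ C t t' → sz t ≡ sz t' → sz (plug C t) ≡ sz (plug C t')
sz-plug hole t t' eq = eq
sz-plug (step y b k ls C rs) t t' eq =
  cong₂ _+_ (bw-node y b k _ _)
    (trans (szL-++ ls (plug C t ∷ rs))
      (trans (cong (λ s → szL ls + (s + szL rs)) (sz-plug C t t' eq)) (sym (szL-++ ls (plug C t' ∷ rs)))))

-- Replacing the hole by a tree of the same size with the same light depth
-- of x leaves the light depth of x in the whole tree unchanged: every light
-- bit on the path above the hole only sees sizes, which are unchanged.
ld-plug-eq : ∀ x C t t' → sz t ≡ sz t' → ldT x t ≡ ldT x t' → ldT x (plug C t) ≡ ldT x (plug C t')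
ld-plug-eq x hole t t' _ ld≡ = ld≡
ld-plug-eq x (step y b k ls C rs) t t' sz≡ ld≡ with x ≡ᵇ y
... | true = refl
... | false rewrite sz-plug (step y b k ls C rs) t t' sz≡ =
  ldL-middle ls (sz-plug C t t' sz≡) (ld-plug-eq x C t t' sz≡ ld≡)
  where
  ldL-middle : ∀ {S d d'} ls → sz d ≡ sz d' → ldT x d ≡ ldT x d' → ldL x S (ls ++ d ∷ rs) ≡ ldL x S (ls ++ d' ∷ rs)
  ldL-middle [] sz≡' ld≡' rewrite sz≡' | ld≡' = refl
  ldL-middle (c ∷ ls) sz≡' ld≡' = cong (ldStep (ldT x c) _) (ldL-middle ls sz≡' ld≡')

ldT-step : ∀ x y b k ls C rs t → x ∉ ctxIds (step y b k ls C rs) →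
  ldT x (plug (step y b k ls C rs) t)
    ≡ Maybe.map (_+ lightBit (sz (plug C t)) (sz (plug (step y b k ls C rs) t))) (ldT x (plug C t))
ldT-step x y b k ls C rs t x∉ with ∉-ctxIds-step ls C rs x∉
... | x≢y , x∉ls , _ , x∉rs rewrite ≢⇒≡ᵇ-false x≢y = skip ls x∉ls
  where
  skip : ∀ {S} ls → x ∉ idsL ls → ldL x S (ls ++ plug C t ∷ rs) ≡ Maybe.map (_+ lightBit (sz (plug C t)) S) (ldT x (plug C t))
  skip {S} [] _ rewrite ldL-absent x S rs x∉rs with ldT x (plug C t)
  ... | just j = refl
  ... | nothing = refl
  skip (c ∷ ls) x∉ls rewrite ldT-absent x c (λ x∈ → x∉ls (∈-++⁺ˡ x∈)) = skip ls (λ x∈ → x∉ls (∈-++⁺ʳ (ids c) x∈))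

ld-plug-suc : ∀ x C t t' → x ∉ ctxIds C → sz t ≡ sz t' → ldT x t' ≡ Maybe.map suc (ldT x t) →
  ldT x (plug C t') ≡ Maybe.map suc (ldT x (plug C t))
ld-plug-suc x hole t t' _ _ shift = shift
ld-plug-suc x C@(step y b k ls C' rs) t t' x∉ sz≡ shift = begin
  ldT x (plug C t')
    ≡⟨ ldT-step x y b k ls C' rs t' x∉ ⟩
  Maybe.map (_+ lightBit (sz (plug C' t')) (sz (plug C t'))) (ldT x (plug C' t'))
    ≡⟨ cong₂ (λ s s' → Maybe.map (_+ lightBit s s') (ldT x (plug C' t')))
             (sym (sz-plug C' t t' sz≡)) (sym (sz-plug C t t' sz≡)) ⟩
  Maybe.map (_+ bit) (ldT x (plug C' t'))
    ≡⟨ cong (Maybe.map (_+ bit)) (ld-plug-suc x C' t t' x∉C' sz≡ shift) ⟩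
  Maybe.map (_+ bit) (Maybe.map suc (ldT x (plug C' t)))
    ≡⟨ map-suc-comm (ldT x (plug C' t)) ⟩
  Maybe.map suc (Maybe.map (_+ bit) (ldT x (plug C' t)))
    ≡⟨ cong (Maybe.map suc) (sym (ldT-step x y b k ls C' rs t x∉)) ⟩
  Maybe.map suc (ldT x (plug C t)) ∎
  where
  open ≡-Reasoning
  x∉C' : x ∉ ctxIds C'
  x∉C' = let _ , _ , x∉C' , _ = ∉-ctxIds-step ls C' rs x∉ in x∉C'
  bit : ℕ
  bit = lightBit (sz (plug C' t)) (sz (plug C t))
  map-suc-comm : ∀ m → Maybe.map (_+ bit) (Maybe.map suc m) ≡ Maybe.map suc (Maybe.map (_+ bit) m)
  map-suc-comm (just j) = refl
  map-suc-comm nothing = refl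

sub-plug : ∀ y C t → y ∉ ctxIds C → sub y (plug C t) ≡ sub y t
sub-plug y hole t _ = refl
sub-plug y (step z b k ls C rs) t y∉ with ∉-ctxIds-step ls C rs y∉
... | y≢z , y∉ls , y∉C , y∉rs rewrite ≢⇒≡ᵇ-false y≢z = trans (skip ls y∉ls) (sub-plug y C t y∉C)
  where
  skip : ∀ ls → y ∉ idsL ls → subL y (ls ++ plug C t ∷ rs) ≡ sub y (plug C t)
  skip [] _ rewrite subL-absent y rs y∉rs with sub y (plug C t)
  ... | just w = refl
  ... | nothing = refl
  skip (c ∷ ls) y∉ls rewrite sub-absent y c (λ y∈ → y∉ls (∈-++⁺ˡ y∈)) = skip ls (λ y∈ → y∉ls (∈-++⁺ʳ (ids c) y∈))

-- The split operation acts only at u: away from u it is the identity, so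
-- it commutes with plugging into a context not containing u.

mutual
  splitGo-away : ∀ u M v p t → u ∉ ids t → splitGo u M v p t ≡ t
  splitGo-away u M v p (node x bl k cs) u∉ rewrite ≢⇒≡ᵇ-false (λ x≡u → ∉-head u∉ (sym x≡u)) =
    cong (node x bl k) (splitL-away u M v x cs (∉-tail u∉))

  splitL-away : ∀ u M v p cs → u ∉ idsL cs → splitL u M v p cs ≡ cs
  splitL-away u M v p [] _ = refl
  splitL-away u M v p (c ∷ cs) u∉ =
    cong₂ _∷_ (splitGo-away u M v (just p) c (λ u∈ → u∉ (∈-++⁺ˡ u∈)))
              (splitL-away u M v p cs (λ u∈ → u∉ (∈-++⁺ʳ (ids c) u∈)))

splitL-++ : ∀ u M v p ls rs → splitL u M v p (ls ++ rs) ≡ splitL u M v p ls ++ splitL u M v p rs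
splitL-++ u M v p [] rs = refl
splitL-++ u M v p (c ∷ ls) rs = cong (_ ∷_) (splitL-++ u M v p ls rs)

-- the split of a plugged tree is the plug of the split hole; the hole sees
-- some parent information p', which only matters through the split set M'
split-plug : ∀ u M v C t → u ∉ ctxIds C → ∀ par →
  ∃ λ p' → splitGo u M v par (plug C t) ≡ plug C (splitGo u M v p' t)
split-plug u M v hole t _ par = par , refl
split-plug u M v (step y b k ls C rs) t u∉ par with ∉-ctxIds-step ls C rs u∉
... | u≢y , u∉ls , u∉C , u∉rs with p' , eq ← split-plug u M v C t u∉C (just y)
  rewrite ≢⇒≡ᵇ-false (λ y≡u → u≢y (sym y≡u)) =
  p' , cong (node y b k) (trans (splitL-++ u M v y ls (plug C t ∷ rs))
         (cong₂ _++_ (splitL-away u M v y ls u∉ls) (cong₂ _∷_ eq (splitL-away u M v y rs u∉rs))))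

splitAt : (Tree → Bool) → ℕ → Tree → Tree
splitAt P v (node u bl k cs) =
  node u bl k (filterᵇ (λ t → not (P t)) cs ++ [ node v false 0 (filterᵇ P cs) ])

splitGo-here : ∀ u M v p bl k cs →
  splitGo u M v p (node u bl k cs) ≡ splitAt (λ t → inM' M p (rootId t)) v (node u bl k cs)
splitGo-here u M v p bl k cs rewrite ≡ᵇ-refl u = refl

lightBit-light : ∀ a b → 2 * a ≤ b → lightBit a b ≡ 1
lightBit-light a b le with b <ᵇ 2 * a in eq
... | false = refl
... | true = ⊥-elim (<⇒≱ (<ᵇ⇒< b (2 * a) (subst T (sym eq) _)) le)

lightBit-heavy : ∀ a b → b < 2 * a → lightBit a b ≡ 0
lightBit-heavy a b lt with b <ᵇ 2 * a in eq
... | true = refl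
... | false = ⊥-elim (subst T eq (<⇒<ᵇ lt))

not-T : ∀ {b} → T (not b) → T b → ⊥
not-T {true} () _
not-T {false} _ ()

module SplitNode (u v : ℕ) (bl : Bool) (k : ℕ) (cs : List Tree) (P : Tree → Bool) where

  A B : List Tree
  A = filterᵇ (λ t → not (P t)) cs
  B = filterᵇ P cs

  V t0 t1 : Tree
  V = node v false 0 B
  t0 = node u bl k cs
  t1 = splitAt P v t0

  -- the new node is white, so the children's sizes just regroup
  szL-split : szL (A ++ [ V ]) ≡ szL cs
  szL-split = begin
    szL (A ++ [ V ])          ≡⟨ szL-++ A [ V ] ⟩
    szL A + (szL B + 0)       ≡⟨ cong (szL A +_) (+-identityʳ (szL B)) ⟩
    szL A + szL B             ≡⟨ cong₂ _+_ (szL≡sumOver A) (szL≡sumOver B) ⟩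
    sumOver sz A + sumOver sz B ≡⟨ sumOver-partition sz P cs ⟩
    sumOver sz cs             ≡⟨ sym (szL≡sumOver cs) ⟩
    szL cs                    ∎
    where open ≡-Reasoning

  sz-split : sz t1 ≡ sz t0
  sz-split = cong₂ _+_ (bw-node u bl k _ cs) szL-split

  sz-V≤ : sz V ≤ sz t1
  sz-V≤ = begin
    sz V                       ≡⟨ sym (+-identityʳ (sz V)) ⟩
    sz V + 0                   ≤⟨ m≤n+m _ (szL A) ⟩
    szL A + (sz V + 0)         ≡⟨ sym (szL-++ A [ V ]) ⟩
    szL (A ++ [ V ])           ≤⟨ m≤n+m _ (bw t1) ⟩
    sz t1                      ∎
    where open ≤-Reasoning

  occ-split : ∀ x → occ x (ids t1) ≡ occ x (ids t0) + occ x [ v ]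
  occ-split x = begin
    occ x (ids t1)                                        ≡⟨ occ-++ x [ u ] (idsL (A ++ [ V ])) ⟩
    occ x [ u ] + occ x (idsL (A ++ [ V ]))               ≡⟨ cong (occ x [ u ] +_) forest ⟩
    occ x [ u ] + (occ x (idsL cs) + occ x [ v ])         ≡⟨ sym (+-assoc (occ x [ u ]) _ _) ⟩
    occ x [ u ] + occ x (idsL cs) + occ x [ v ]           ≡⟨ cong (_+ occ x [ v ]) (sym (occ-++ x [ u ] (idsL cs))) ⟩
    occ x (ids t0) + occ x [ v ]                          ∎
    where
    open ≡-Reasoning
    f : Tree → ℕ
    f t = occ x (ids t)
    forest : occ x (idsL (A ++ [ V ])) ≡ occ x (idsL cs) + occ x [ v ]
    forest = begin
      occ x (idsL (A ++ [ V ]))                   ≡⟨ occ-idsL≡sumOver x (A ++ [ V ]) ⟩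
      sumOver f (A ++ [ V ])                       ≡⟨ sumOver-++ f A [ V ] ⟩
      sumOver f A + (occ x (v ∷ idsL B) + 0)       ≡⟨ cong (sumOver f A +_) (+-identityʳ _) ⟩
      sumOver f A + occ x (v ∷ idsL B)             ≡⟨ cong (sumOver f A +_) (occ-++ x [ v ] (idsL B)) ⟩
      sumOver f A + (occ x [ v ] + occ x (idsL B)) ≡⟨ cong (λ n → sumOver f A + (occ x [ v ] + n)) (occ-idsL≡sumOver x B) ⟩
      sumOver f A + (occ x [ v ] + sumOver f B)    ≡⟨ cong (sumOver f A +_) (+-comm (occ x [ v ]) _) ⟩
      sumOver f A + (sumOver f B + occ x [ v ])    ≡⟨ sym (+-assoc (sumOver f A) _ _) ⟩
      sumOver f A + sumOver f B + occ x [ v ]      ≡⟨ cong (_+ occ x [ v ]) (sumOver-partition f P cs) ⟩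
      sumOver f cs + occ x [ v ]                   ≡⟨ cong (_+ occ x [ v ]) (sym (occ-idsL≡sumOver x cs)) ⟩
      occ x (idsL cs) + occ x [ v ]                ∎

  module WithDistinctLabels (dist : Distinct (ids t0)) (fresh : v ∉ ids t0) where

    ∈A⁻ : ∀ {d} → d ∈ A → d ∈ cs × T (not (P d))
    ∈A⁻ = ∈-filter⁻ (λ t → T? (not (P t))) {xs = cs}

    ∈B⁻ : ∀ {d} → d ∈ B → d ∈ cs × T (P d)
    ∈B⁻ = ∈-filter⁻ (λ t → T? (P t)) {xs = cs}

    moved-child : ∀ {d} → d ∈ B → d ∈ cs
    moved-child d∈B = proj₁ (∈B⁻ d∈B)

    stayed-child : ∀ {d} → d ∈ A → d ∈ cs
    stayed-child d∈A = proj₁ (∈A⁻ d∈A)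

    occ-cs : ∀ x → occ x (idsL cs) ≤ 1
    occ-cs x = ≤-trans (m≤n+m _ (occ x [ u ])) (subst (_≤ 1) (occ-++ x [ u ] (idsL cs)) (dist x))

    child-label≢u : ∀ {x c} → c ∈ cs → x ∈ ids c → x ≢ u
    child-label≢u c∈ x∈c refl =
      distinct-disjoint [ u ] (idsL cs) (dist u) (here refl) (∈-idsL⁺ cs c∈ x∈c)

    child-label≢v : ∀ {x c} → c ∈ cs → x ∈ ids c → x ≢ v
    child-label≢v c∈ x∈c refl = fresh (there (∈-idsL⁺ cs c∈ x∈c))

    only-in : ∀ {x c} → c ∈ cs → x ∈ ids c → ∀ d → d ∈ cs → x ∈ ids d → d ≡ c
    only-in c∈ x∈c d d∈ x∈d = containing-tree-unique cs (occ-cs _) d∈ c∈ x∈d x∈c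

    only-in-V : ∀ {x c} → c ∈ B → x ∈ ids c → ∀ d → d ∈ A ++ [ V ] → x ∈ ids d → d ≡ V
    only-in-V c∈B x∈c d d∈ x∈d with ∈-++⁻ A d∈
    ... | inj₂ (here d≡V) = d≡V
    ... | inj₁ d∈A with refl ← only-in (moved-child c∈B) x∈c d (stayed-child d∈A) x∈d =
      ⊥-elim (not-T (proj₂ (∈A⁻ d∈A)) (proj₂ (∈B⁻ c∈B)))

    only-in-stayed : ∀ {x c} → c ∈ A → x ∈ ids c → ∀ d → d ∈ A ++ [ V ] → x ∈ ids d → d ≡ c
    only-in-stayed c∈A x∈c d d∈ x∈d with ∈-++⁻ A d∈
    ... | inj₁ d∈A = only-in (stayed-child c∈A) x∈c d (stayed-child d∈A) x∈d
    ... | inj₂ (here refl) with x∈d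
    ...   | here refl = ⊥-elim (child-label≢v (stayed-child c∈A) x∈c refl)
    ...   | there x∈B with d' , d'∈B , x∈d' ← ∈-idsL⁻ B x∈B
      with refl ← only-in (stayed-child c∈A) x∈c d' (moved-child d'∈B) x∈d' =
      ⊥-elim (not-T (proj₂ (∈A⁻ c∈A)) (proj₂ (∈B⁻ d'∈B)))

    only-in-B : ∀ {x c} → c ∈ B → x ∈ ids c → ∀ d → d ∈ B → x ∈ ids d → d ≡ c
    only-in-B c∈B x∈c d d∈B = only-in (moved-child c∈B) x∈c d (moved-child d∈B)

    sub-V : sub v t1 ≡ just V
    sub-V rewrite ≢⇒≡ᵇ-false (λ v≡u → fresh (here v≡u)) =
      subL-through v V V (A ++ [ V ]) (∈-++⁺ʳ A (here refl)) (sub-root V) only-V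
      where
      only-V : ∀ d → d ∈ A ++ [ V ] → v ∈ ids d → d ≡ V
      only-V d d∈ v∈d with ∈-++⁻ A d∈
      ... | inj₁ d∈A = ⊥-elim (child-label≢v (stayed-child d∈A) v∈d refl)
      ... | inj₂ (here d≡V) = d≡V

    sub-moved : ∀ c → c ∈ B → sub (rootId c) t1 ≡ just c
    sub-moved c c∈B
      rewrite ≢⇒≡ᵇ-false (child-label≢u (moved-child c∈B) (rootId∈ids c)) =
      subL-through (rootId c) V c (A ++ [ V ]) (∈-++⁺ʳ A (here refl)) sub-in-V (only-in-V c∈B (rootId∈ids c))
      where
      sub-in-V : sub (rootId c) V ≡ just c
      sub-in-V rewrite ≢⇒≡ᵇ-false (child-label≢v (moved-child c∈B) (rootId∈ids c)) =
        subL-through (rootId c) c c B c∈B (sub-root c) (only-in-B c∈B (rootId∈ids c))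

    ld-before : ∀ {x c j} → c ∈ cs → x ∈ ids c → ldT x c ≡ just j →
      ldT x t0 ≡ just (j + lightBit (sz c) (sz t0))
    ld-before {x} {c} {j} c∈ x∈c eq rewrite ≢⇒≡ᵇ-false (child-label≢u c∈ x∈c) =
      ldL-through x (sz t0) c j cs c∈ eq (only-in c∈ x∈c)

    ld-moved : ∀ {x c j} → c ∈ B → x ∈ ids c → ldT x c ≡ just j →
      ldT x t1 ≡ just (j + lightBit (sz c) (sz V) + lightBit (sz V) (sz t1))
    ld-moved {x} {c} {j} c∈B x∈c eq
      rewrite ≢⇒≡ᵇ-false (child-label≢u (moved-child c∈B) x∈c) =
      ldL-through x (sz t1) V _ (A ++ [ V ]) (∈-++⁺ʳ A (here refl)) ld-in-V (only-in-V c∈B x∈c)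
      where
      ld-in-V : ldT x V ≡ just (j + lightBit (sz c) (sz V))
      ld-in-V rewrite ≢⇒≡ᵇ-false (child-label≢v (moved-child c∈B) x∈c) =
        ldL-through x (sz V) c j B c∈B eq (only-in-B c∈B x∈c)

    ld-stayed : ∀ {x c j} → c ∈ A → x ∈ ids c → ldT x c ≡ just j →
      ldT x t1 ≡ just (j + lightBit (sz c) (sz t1))
    ld-stayed {x} {c} {j} c∈A x∈c eq rewrite ≢⇒≡ᵇ-false (child-label≢u (stayed-child c∈A) x∈c) =
      ldL-through x (sz t1) c j (A ++ [ V ]) (∈-++⁺ˡ c∈A) eq (only-in-stayed c∈A x∈c)

    -- Case 1: c is light below v, and v light below u.  Both new edges on
    -- the path of x are light, while the old edge c-u was light too.
    ld-split-light : ∀ c → c ∈ B → 2 * sz c ≤ sz V → 2 * sz V ≤ sz t1 →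
      ∀ x → x ∈ ids c → ldT x t1 ≡ Maybe.map suc (ldT x t0)
    ld-split-light c c∈B c-light V-light x x∈c with j , eq ← ldT-present x c x∈c = begin
      ldT x t1
        ≡⟨ ld-moved c∈B x∈c eq ⟩
      just (j + lightBit (sz c) (sz V) + lightBit (sz V) (sz t1))
        ≡⟨ cong₂ (λ a b → just (j + a + b))
                 (lightBit-light (sz c) (sz V) c-light) (lightBit-light (sz V) (sz t1) V-light) ⟩
      just (j + 1 + 1)
        ≡⟨ cong just (+-comm (j + 1) 1) ⟩
      just (suc (j + 1))
        ≡⟨ cong (λ b → just (suc (j + b))) (sym (lightBit-light (sz c) (sz t0) c-light-before)) ⟩
      Maybe.map suc (just (j + lightBit (sz c) (sz t0)))
        ≡⟨ cong (Maybe.map suc) (sym (ld-before (moved-child c∈B) x∈c eq)) ⟩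
      Maybe.map suc (ldT x t0) ∎
      where
      open ≡-Reasoning
      c-light-before : 2 * sz c ≤ sz t0
      c-light-before = ≤-trans c-light (≤-trans sz-V≤ (≤-reflexive sz-split))

    -- Case 2: c is heavy below v and v heavy below u, but the old edge c-u
    -- was light: the path of x loses one light edge.
    ld-split-heavy : ∀ c → c ∈ B → sz V < 2 * sz c → sz t1 < 2 * sz V → 2 * sz c ≤ sz t1 →
      ∀ x → x ∈ ids c → ldT x t0 ≡ Maybe.map suc (ldT x t1)
    ld-split-heavy c c∈B c-heavy V-heavy c-light-before x x∈c with j , eq ← ldT-present x c x∈c = begin
      ldT x t0
        ≡⟨ ld-before (moved-child c∈B) x∈c eq ⟩
      just (j + lightBit (sz c) (sz t0))
        ≡⟨ cong (λ b → just (j + b)) (lightBit-light (sz c) (sz t0) (subst (2 * sz c ≤_) sz-split c-light-before)) ⟩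
      just (j + 1)
        ≡⟨ cong just (trans (+-comm j 1) (cong suc (sym (trans (+-identityʳ (j + 0)) (+-identityʳ j))))) ⟩
      just (suc (j + 0 + 0))
        ≡⟨ cong₂ (λ a b → just (suc (j + a + b)))
                 (sym (lightBit-heavy (sz c) (sz V) c-heavy)) (sym (lightBit-heavy (sz V) (sz t1) V-heavy)) ⟩
      Maybe.map suc (just (j + lightBit (sz c) (sz V) + lightBit (sz V) (sz t1)))
        ≡⟨ cong (Maybe.map suc) (sym (ld-moved c∈B x∈c eq)) ⟩
      Maybe.map suc (ldT x t1) ∎
      where open ≡-Reasoning

    -- Case 3 (v heavy below u, and no child of v switches from light to
    -- heavy): for a moved child c the edge v-u adds nothing and the bit of
    -- c-v equals the old bit of c-u; for a staying child the bit of c-u is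
    -- unchanged since s(u) is.
    module Unchanged (V-heavy : sz t1 < 2 * sz V)
                     (no-switch : ∀ c → c ∈ B → sz V < 2 * sz c → 2 * sz c ≤ sz t1 → ⊥) where

      bit-moved : ∀ c → c ∈ B → lightBit (sz c) (sz V) ≡ lightBit (sz c) (sz t0)
      bit-moved c c∈B with sz V <? 2 * sz c
      ... | yes c-heavy = trans (lightBit-heavy (sz c) (sz V) c-heavy)
              (sym (lightBit-heavy (sz c) (sz t0) (subst (_< 2 * sz c) sz-split (≰⇒> (no-switch c c∈B c-heavy)))))
      ... | no c-light = trans (lightBit-light (sz c) (sz V) (≮⇒≥ c-light))
              (sym (lightBit-light (sz c) (sz t0) (≤-trans (≮⇒≥ c-light) (≤-trans sz-V≤ (≤-reflexive sz-split)))))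

      ld-child : ∀ {x c} → c ∈ cs → x ∈ ids c → ldT x t1 ≡ ldT x t0
      ld-child {x} {c} c∈cs x∈c with j , eq ← ldT-present x c x∈c with P c in moved
      ... | true = begin
        ldT x t1                                                    ≡⟨ ld-moved c∈B x∈c eq ⟩
        just (j + lightBit (sz c) (sz V) + lightBit (sz V) (sz t1)) ≡⟨ cong (λ b → just (j + lightBit (sz c) (sz V) + b))
                                                                       (lightBit-heavy (sz V) (sz t1) V-heavy) ⟩
        just (j + lightBit (sz c) (sz V) + 0)                       ≡⟨ cong just (+-identityʳ _) ⟩
        just (j + lightBit (sz c) (sz V))                           ≡⟨ cong (λ b → just (j + b)) (bit-moved c c∈B) ⟩
        just (j + lightBit (sz c) (sz t0))                          ≡⟨ sym (ld-before c∈cs x∈c eq) ⟩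
        ldT x t0                                                    ∎
        where
        open ≡-Reasoning
        c∈B : c ∈ B
        c∈B = ∈-filter⁺ (λ t → T? (P t)) c∈cs (subst T (sym moved) _)
      ... | false = begin
        ldT x t1                           ≡⟨ ld-stayed c∈A x∈c eq ⟩
        just (j + lightBit (sz c) (sz t1)) ≡⟨ cong (λ s → just (j + lightBit (sz c) s)) sz-split ⟩
        just (j + lightBit (sz c) (sz t0)) ≡⟨ sym (ld-before c∈cs x∈c eq) ⟩
        ldT x t0                           ∎
        where
        open ≡-Reasoning
        c∈A : c ∈ A
        c∈A = ∈-filter⁺ (λ t → T? (not (P t))) c∈cs (subst (λ b → T (not b)) (sym moved) _)

      absent-after : ∀ {x} → x ≢ v → x ∉ idsL cs → x ∉ idsL (A ++ [ V ])
      absent-after {x} x≢v x∉cs x∈ with ∈-++⁻ (idsL A) (subst (x ∈_) (idsL-++ A [ V ]) x∈)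
      ... | inj₁ x∈A = let d , d∈A , x∈d = ∈-idsL⁻ A x∈A in x∉cs (∈-idsL⁺ cs (stayed-child d∈A) x∈d)
      ... | inj₂ x∈V with ∈-++⁻ (ids V) x∈V
      ...   | inj₂ ()
      ...   | inj₁ (here x≡v) = x≢v x≡v
      ...   | inj₁ (there x∈B) = let d , d∈B , x∈d = ∈-idsL⁻ B x∈B in x∉cs (∈-idsL⁺ cs (moved-child d∈B) x∈d)

      ld-split-unchanged : ∀ x → x ≢ v → ldT x t1 ≡ ldT x t0
      ld-split-unchanged x x≢v with x ≟ u
      ... | yes refl rewrite ≡ᵇ-refl x = refl
      ... | no x≢u with x ∈? idsL cs
      ...   | yes x∈cs = let c , c∈cs , x∈c = ∈-idsL⁻ cs x∈cs in ld-child c∈cs x∈c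
      ...   | no x∉cs rewrite ≢⇒≡ᵇ-false x≢u =
        trans (ldL-absent x (sz t1) (A ++ [ V ]) (absent-after x≢v x∉cs)) (sym (ldL-absent x (sz t0) cs x∉cs))

record SplitSite (T : Tree) (u : ℕ) (M : List ℕ) (v : ℕ) : Set where
  field
    ctx : Ctx
    k : ℕ
    cs : List Tree
    moved : Tree → Bool
    tree≡ : T ≡ plug ctx (node u false k cs)
    split≡ : split u M v T ≡ plug ctx (splitAt moved v (node u false k cs))

split-site : ∀ {T u} M v → White T u → Distinct (ids T) → SplitSite T u M v
split-site {T} {u} M v (k , cs , sub≡) dist with C , refl ← sub⇒plug u T _ sub≡
  with p' , split≡ ← split-plug u M v C (node u false k cs)
                       (distinct-plug-apart C _ dist (here refl)) nothing =
  record { ctx = C ; k = k ; cs = cs ; moved = λ t → inM' M p' (rootId t) ; tree≡ = refl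
         ; split≡ = trans split≡ (cong (plug C) (splitGo-here u M v p' false k cs)) }

idsL-leaves : ∀ is → idsL (map (λ i → node (suc i) true 1 []) is) ≡ map suc is
idsL-leaves [] = refl
idsL-leaves (i ∷ is) = cong (suc i ∷_) (idsL-leaves is)

star-distinct : ∀ B → Distinct (ids (star B))
star-distinct B rewrite idsL-leaves (upTo B) =
  unique⇒distinct (tabulate 0∉ ∷ Unique.map⁺ suc-injective (Unique.upTo⁺ B))
  where
  0∉ : ∀ {y} → y ∈ map suc (upTo B) → 0 ≢ y
  0∉ y∈ 0≡y with i , _ , y≡1+i ← ∈-map⁻ suc y∈ = 0≢1+n (trans 0≡y y≡1+i)

findChild-occ : ∀ c ts t rest x → findChild c ts ≡ just (t , rest) →
  occ x (idsL ts) ≡ occ x (ids t) + occ x (idsL rest)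
findChild-occ c (t ∷ ts) t' rest x found with rootId t ≡ᵇ c | findChild c ts in found'
... | true | _ with refl ← found = occ-++ x (ids t) (idsL ts)
... | false | just (t'' , rest'') with refl ← found = begin
  occ x (ids t ++ idsL ts)                 ≡⟨ occ-++ x (ids t) (idsL ts) ⟩
  a + occ x (idsL ts)                      ≡⟨ cong (a +_) (findChild-occ c ts t'' rest'' x found') ⟩
  a + (b + occ x (idsL rest''))            ≡⟨ sym (+-assoc a b _) ⟩
  a + b + occ x (idsL rest'')              ≡⟨ cong (_+ occ x (idsL rest'')) (+-comm a b) ⟩
  b + a + occ x (idsL rest'')              ≡⟨ +-assoc b a _ ⟩
  b + (a + occ x (idsL rest''))            ≡⟨ cong (b +_) (sym (occ-++ x (ids t) (idsL rest''))) ⟩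
  b + occ x (ids t ++ idsL rest'')         ∎
  where
  open ≡-Reasoning
  a = occ x (ids t)
  b = occ x (ids t'')

mutual
  occ-contract : ∀ c t x → occ x (ids (contractGo c t)) ≤ occ x (ids t)
  occ-contract c (node y bl k cs) x with findChild c cs in found
  ... | just (node z _ _ ccs , rest) = occ-∷-mono x y (idsL (rest ++ ccs)) (idsL cs) (begin
    occ x (idsL (rest ++ ccs))               ≡⟨ cong (occ x) (idsL-++ rest ccs) ⟩
    occ x (idsL rest ++ idsL ccs)            ≡⟨ occ-++ x (idsL rest) (idsL ccs) ⟩
    occ x (idsL rest) + occ x (idsL ccs)     ≡⟨ +-comm (occ x (idsL rest)) _ ⟩
    occ x (idsL ccs) + occ x (idsL rest)     ≤⟨ +-monoˡ-≤ (occ x (idsL rest)) (occ-∷-right x z (idsL ccs)) ⟩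
    occ x (z ∷ idsL ccs) + occ x (idsL rest) ≡⟨ sym (findChild-occ c cs _ rest x found) ⟩
    occ x (idsL cs)                          ∎)
    where open ≤-Reasoning
  ... | nothing = occ-∷-mono x y (idsL (contractL c cs)) (idsL cs) (occ-contractL c cs x)

  occ-contractL : ∀ c ts x → occ x (idsL (contractL c ts)) ≤ occ x (idsL ts)
  occ-contractL c [] x = z≤n
  occ-contractL c (t ∷ ts) x
    rewrite occ-++ x (ids (contractGo c t)) (idsL (contractL c ts)) | occ-++ x (ids t) (idsL ts) =
    +-mono-≤ (occ-contract c t x) (occ-contractL c ts x)

distinct-add-fresh : ∀ {xs} ys {v} → Distinct xs → v ∉ xs → (∀ x → occ x ys ≡ occ x xs + occ x [ v ]) → Distinct ys
distinct-add-fresh {xs} ys {v} dist v∉ occ≡ x with x ≟ v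
... | yes refl rewrite occ≡ x | ∉⇒occ-zero v∉ | occ-head x [] = ≤-refl
... | no x≢v rewrite occ≡ x | ≢⇒≡ᵇ-false x≢v | +-identityʳ (occ x xs) = dist x

distinct-reachable : ∀ {B T} → Reachable B T → Distinct (ids T)
distinct-reachable {B} start = star-distinct B
distinct-reachable (byContract {T} c R _) x = ≤-trans (occ-contract c T x) (distinct-reachable R x)
distinct-reachable (bySplit {T} u M v R pre) with split-site {T} M v (SplitPre.white pre) (distinct-reachable R)
... | record { ctx = C ; k = k ; cs = cs ; moved = P ; tree≡ = refl ; split≡ = split≡ } rewrite split≡ =
  distinct-add-fresh (ids (plug C (splitAt P v t0))) (distinct-reachable R) (SplitPre.fresh pre) occ-after
  where
  t0 = node u false k cs
  occ-after : ∀ x → occ x (ids (plug C (splitAt P v t0))) ≡ occ x (ids (plug C t0)) + occ x [ v ]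
  occ-after x = begin
    occ x (ids (plug C (splitAt P v t0)))                  ≡⟨ occ-plug x C _ ⟩
    occ x (ctxIds C) + occ x (ids (splitAt P v t0))        ≡⟨ cong (occ x (ctxIds C) +_) (SplitNode.occ-split u v false k cs P x) ⟩
    occ x (ctxIds C) + (occ x (ids t0) + occ x [ v ])      ≡⟨ sym (+-assoc (occ x (ctxIds C)) _ _) ⟩
    occ x (ctxIds C) + occ x (ids t0) + occ x [ v ]        ≡⟨ cong (_+ occ x [ v ]) (sym (occ-plug x C t0)) ⟩
    occ x (ids (plug C t0)) + occ x [ v ]                  ∎
    where open ≡-Reasoning

module AtSplitSite (C : Ctx) (u v k : ℕ) (cs : List Tree) (P : Tree → Bool)
                   (dist : Distinct (ids (plug C (node u false k cs))))
                   (fresh : v ∉ ids (plug C (node u false k cs))) where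

  open SplitNode u v false k cs P
  open WithDistinctLabels (distinct-plug-hole C t0 dist) (λ v∈ → fresh (∈-plug-hole C t0 v∈))

  T₀ T₁ : Tree
  T₀ = plug C t0
  T₁ = plug C t1

  hole-label : ∀ {x} → x ∈ ids t0 → x ∉ ctxIds C
  hole-label = distinct-plug-apart C t0 dist

  v∉ctx : v ∉ ctxIds C
  v∉ctx v∈ = fresh (∈-plug-ctx C t0 v∈)

  moved-label : ∀ {x c} → c ∈ B → x ∈ ids c → x ∈ ids t0
  moved-label c∈B x∈c = there (∈-idsL⁺ cs (moved-child c∈B) x∈c)

  size-u : size T₁ u ≡ sz t1
  size-u = cong (maybe sz 0) (trans (sub-plug u C t1 (hole-label (here refl))) (sub-root t1))

  sub-v : sub v T₁ ≡ just V
  sub-v = trans (sub-plug v C t1 v∉ctx) sub-V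

  size-v : size T₁ v ≡ sz V
  size-v = cong (maybe sz 0) sub-v

  sub-moved-in-T₁ : ∀ c → c ∈ B → sub (rootId c) T₁ ≡ just c
  sub-moved-in-T₁ c c∈B = trans (sub-plug (rootId c) C t1 (hole-label (moved-label c∈B (rootId∈ids c)))) (sub-moved c c∈B)

  childIds-v : childIds T₁ v ≡ map rootId B
  childIds-v = cong (maybe (λ t → map rootId (children t)) []) sub-v

  child-of-v : ∀ c → c ∈ childIds T₁ v → ∃ λ c' → c' ∈ B × sub c T₁ ≡ just c'
  child-of-v c c∈ with c' , c'∈B , refl ← ∈-map⁻ rootId (subst (c ∈_) childIds-v c∈) =
    c' , c'∈B , sub-moved-in-T₁ c' c'∈B

  heavy-v⇔ : Heavy T₁ v u ≡ (sz t1 < 2 * sz V)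
  heavy-v⇔ = cong₂ (λ a b → a < 2 * b) size-u size-v

  heavy-c⇔ : ∀ {c c'} → sub c T₁ ≡ just c' → Heavy T₁ c v ≡ (sz V < 2 * sz c')
  heavy-c⇔ sub≡ = cong₂ (λ a b → a < 2 * b) size-v (cong (maybe sz 0) sub≡)

  light-c⇔ : ∀ {c c'} → sub c T₁ ≡ just c' → (2 * size T₁ c ≤ size T₁ u) ≡ (2 * sz c' ≤ sz t1)
  light-c⇔ sub≡ = cong₂ (λ a b → 2 * a ≤ b) (cong (maybe sz 0) sub≡) size-u

  case-light : ¬ Heavy T₁ v u → ∀ c → c ∈ childIds T₁ v → ¬ Heavy T₁ c v →
    ∀ x → x ∈ subIds T₁ c → ld T₁ x ≡ Maybe.map suc (ld T₀ x)
  case-light v-light c c∈ c-light x x∈ with c' , c'∈B , sub≡ ← child-of-v c c∈ =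
    ld-plug-suc x C t0 t1 (hole-label (moved-label c'∈B x∈c')) (sym sz-split)
      (ld-split-light c' c'∈B (≮⇒≥ (λ h → c-light (subst id (sym (heavy-c⇔ sub≡)) h)))
                              (≮⇒≥ (λ h → v-light (subst id (sym heavy-v⇔) h))) x x∈c')
    where
    x∈c' : x ∈ ids c'
    x∈c' = subst (x ∈_) (cong (maybe ids []) sub≡) x∈

  case-heavy : Heavy T₁ v u → ∀ c → c ∈ childIds T₁ v → Heavy T₁ c v → 2 * size T₁ c ≤ size T₁ u →
    ∀ x → x ∈ subIds T₁ c → Maybe.map suc (ld T₁ x) ≡ ld T₀ x
  case-heavy v-heavy c c∈ c-heavy c-light-before x x∈ with c' , c'∈B , sub≡ ← child-of-v c c∈ =
    sym (ld-plug-suc x C t1 t0 (hole-label (moved-label c'∈B x∈c')) sz-split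
      (ld-split-heavy c' c'∈B (subst id (heavy-c⇔ sub≡) c-heavy) (subst id heavy-v⇔ v-heavy)
                              (subst id (light-c⇔ sub≡) c-light-before) x x∈c'))
    where
    x∈c' : x ∈ ids c'
    x∈c' = subst (x ∈_) (cong (maybe ids []) sub≡) x∈

  case-unchanged : Heavy T₁ v u →
    ¬ (∃ λ c → c ∈ childIds T₁ v × Heavy T₁ c v × 2 * size T₁ c ≤ size T₁ u) →
    ∀ x → x ∈ ids T₀ → ld T₁ x ≡ ld T₀ x
  case-unchanged v-heavy no-switch x x∈T₀ =
    ld-plug-eq x C t1 t0 sz-split (Unchanged.ld-split-unchanged (subst id heavy-v⇔ v-heavy) no-switch' x x≢v)
    where
    x≢v : x ≢ v
    x≢v refl = fresh x∈T₀
    no-switch' : ∀ c → c ∈ B → sz V < 2 * sz c → 2 * sz c ≤ sz t1 → ⊥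
    no-switch' c c∈B c-heavy c-light-before =
      no-switch (rootId c , subst (rootId c ∈_) (sym childIds-v) (∈-map⁺ rootId c∈B)
                , subst id (sym (heavy-c⇔ (sub-moved-in-T₁ c c∈B))) c-heavy
                , subst id (sym (light-c⇔ (sub-moved-in-T₁ c c∈B))) c-light-before)

lemma37 : (B : ℕ) (T : Tree) (u : ℕ) (M : List ℕ) (v : ℕ) →
    Reachable B T → SplitPre T u M v →
    ((¬ Heavy (split u M v T) v u) →
       ∀ c → c ∈ childIds (split u M v T) v → ¬ Heavy (split u M v T) c v →
       ∀ x → x ∈ subIds (split u M v T) c →
       ld (split u M v T) x ≡ Data.Maybe.map suc (ld T x))
    × (Heavy (split u M v T) v u →
       ∀ c → c ∈ childIds (split u M v T) v → Heavy (split u M v T) c v →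
       2 * size (split u M v T) c ≤ size (split u M v T) u →
       ∀ x → x ∈ subIds (split u M v T) c →
       Data.Maybe.map suc (ld (split u M v T) x) ≡ ld T x)
    × (Heavy (split u M v T) v u →
       ¬ (∃ λ c → c ∈ childIds (split u M v T) v × Heavy (split u M v T) c v
                  × 2 * size (split u M v T) c ≤ size (split u M v T) u) →
       ∀ x → x ∈ ids T → ld (split u M v T) x ≡ ld T x)
lemma37 B T u M v reachable pre
  with split-site {T} M v (SplitPre.white pre) (distinct-reachable reachable)
... | record { ctx = C ; k = k ; cs = cs ; moved = P ; tree≡ = refl ; split≡ = split≡ } rewrite split≡ =
  case-light , case-heavy , case-unchanged
  where open AtSplitSite C u v k cs P (distinct-reachable reachable) (SplitPre.fresh pre)
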